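{- For all $p,q\ge1$, $j\in[p]$ and $l\in[q]$, $$e_j^p\cdot e_l^q=\sum_{i=l}^{p+l}\binom{i-1}{l-1}\binom{p+q-i}{q-l}\,e_i^{p+q}.$$
   Context: Let $E_n$ be the edgeless graph on nodes $1,\dots,n$, and $D_n$ the set of its $n$-tubings: the universal tube $[n]$ together with all singletons $\{i\}$ except one. $\Delta Sym$ is the graded $\mathbb{Q}$-algebra with degree-$n$ basis $\{F_u:u\in D_n\}$ and product $F_u\cdot F_v=\sum_{\iota\in S^{(p,q)}}F_{w_\iota}$ for $u\in D_p$, $v\in D_q$, where $S^{(p,q)}$ is the set of permutations $\iota$ of $[p+q]$ increasing on $\{1,\dots,p\}$ and on $\{p+1,\dots,p+q\}$, $\hat\iota(i)=\iota(p+i)$, and $w_\iota$ consists of the singletons $\{\iota(i)\}$, $i\in[p]$, the tubes $\hat\iota(t)$ for non-universal tubes $t\in v$, and $[p+q]$. Let $e_m^n$ be the standard basis column vector of $\mathbb{Q}^n$ with $1$ in position $m$; identify $e_j^n$ with $F_u$ where $u\in D_n$ is the tubing in which node $j$ is the only node that is not a singleton tube. The product $e_u\cdot e_v$ of standard basis vectors is defined as the sum of $e_w$ over the terms $F_w$ (with multiplicity) of $F_u\cdot F_v$. -}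

module Defs where

open import Data.Nat as ℕ using (ℕ; zero; suc; _∸_; _≤ᵇ_)
open import Data.Nat.Combinatorics using (_C_)
open import Data.Bool using (Bool; true; false; _∧_; if_then_else_)
import Data.Bool.Properties as BoolP
open import Data.Fin as Fin using (Fin; toℕ; _↑ˡ_; _↑ʳ_; _<_; _<?_)
open import Data.Fin.Properties using (all?; any?) renaming (_≟_ to _≟ᶠ_)
open import Data.Fin.Subset using (Subset; ∁; ⁅_⁆; inside)
open import Data.Vec using (Vec; []; _∷_; lookup; tabulate)
open import Data.Vec.Properties using (≡-dec)
open import Data.List using (List; []; _∷_; map; concatMap; filter; length; allFin)
open import Data.Product using (Σ; ∃; _×_; _,_)
open import Data.Integer using (+_)
open import Data.Rational using (ℚ; 0ℚ; _/_; _+_; _*_)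
open import Relation.Nullary using (Dec; yes; no; ¬_; does)
open import Relation.Nullary.Decidable using (_×-dec_; _→-dec_)
open import Relation.Binary.PropositionalEquality using (_≡_)

-- Nodes of E_n are Fin n; node k : Fin n is the paper's node (toℕ k + 1).
-- An n-tubing of the edgeless graph E_n consists of the universal tube
-- [n] together with some singleton tubes.  We represent a tubing by the
-- Subset n of nodes i for which {i} is a tube (the universal tube is
-- always present and left implicit).

Tubing : ℕ → Set
Tubing n = Subset n

-- The element of D_n in which node j is the only non-singleton node.
tub : ∀ {n} → Fin n → Tubing n
tub j = ∁ ⁅ j ⁆

Perm : ℕ → Set
Perm n = Vec (Fin n) n

-- ι is a permutation (surjective self-map of a finite set, hence bijective)
IsPerm : ∀ {n} → Perm n → Set
IsPerm {n} ι = ∀ (k : Fin n) → ∃ λ m → lookup ι m ≡ k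

IsShuffle : ∀ p q → Perm (p ℕ.+ q) → Set
IsShuffle p q ι =
  IsPerm ι
  × (∀ (a b : Fin p) → a < b → lookup ι ((a ↑ˡ q)) < lookup ι ((b ↑ˡ q)))
  × (∀ (a b : Fin q) → a < b → lookup ι ((p ↑ʳ a)) < lookup ι ((p ↑ʳ b)))

isShuffle? : ∀ p q (ι : Perm (p ℕ.+ q)) → Dec (IsShuffle p q ι)
isShuffle? p q ι =
  all? (λ k → any? (λ m → lookup ι m ≟ᶠ k))
  ×-dec all? (λ a → all? (λ b → (a <? b) →-dec (lookup ι ((a ↑ˡ q)) <? lookup ι ((b ↑ˡ q)))))
  ×-dec all? (λ a → all? (λ b → (a <? b) →-dec (lookup ι ((p ↑ʳ a)) <? lookup ι ((p ↑ʳ b)))))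

-- The tubing w_ι (for v ∈ D_q): singletons {ι(i)} for i ∈ [p], the
-- images ι̂(t) = {ι(p+k)} of the non-universal tubes t = {k} of v, and
-- the (implicit) universal tube [p+q].
wTub : ∀ p q → Perm (p ℕ.+ q) → Tubing q → Tubing (p ℕ.+ q)
wTub p q ι v = tabulate λ k →
  does (any? (λ (a : Fin p) → lookup ι ((a ↑ˡ q)) ≟ᶠ k))
  Data.Bool.∨
  does (any? (λ (b : Fin q) → (lookup v b BoolP.≟ true) ×-dec (lookup ι ((p ↑ʳ b)) ≟ᶠ k)))

allVecs : ∀ m n → List (Vec (Fin n) m)
allVecs zero    n = [] ∷ []
allVecs (suc m) n = concatMap (λ x → map (x ∷_) (allVecs m n)) (allFin n)

-- Multiplicity of F_w in F_u · F_v : the number of ι ∈ S^(p,q) with w_ι = w.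
-- (u does not influence w_ι, exactly as in the paper's definition.)
prodMult : ∀ {p q} → Tubing p → Tubing q → Tubing (p ℕ.+ q) → ℕ
prodMult {p} {q} u v w =
  length (filter (λ ι → isShuffle? p q ι ×-dec ≡-dec BoolP._≟_ (wTub p q ι v) w)
                 (allVecs (p ℕ.+ q) (p ℕ.+ q)))

Vecℚ : ℕ → Set
Vecℚ n = Fin n → ℚ

fromℕℚ : ℕ → ℚ
fromℕℚ n = + n / 1

zeroV : ∀ {n} → Vecℚ n
zeroV _ = 0ℚ

_+V_ : ∀ {n} → Vecℚ n → Vecℚ n → Vecℚ n
(x +V y) k = x k + y k

_•V_ : ∀ {n} → ℚ → Vecℚ n → Vecℚ n
(c •V x) k = c * x k

-- standard basis vector e_m^n (1-based index m : ℕ)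
e : (n m : ℕ) → Vecℚ n
e n m k = if (suc (toℕ k) ℕ.≡ᵇ m) then fromℕℚ 1 else 0ℚ

-- e_j^p · e_l^q (1-based j, l given as Fin p, Fin q): the sum of e_w over
-- the terms F_w of F_{u_j} · F_{u_l}, where e_i^{p+q} ↔ F_{u_i}.
eProd : ∀ {p q} → Fin p → Fin q → Vecℚ (p ℕ.+ q)
eProd {p} {q} j l i = fromℕℚ (prodMult (tub j) (tub l) (tub i))

-- Σ_{i=a}^{b} f i  (empty if b < a)
sumFromTo : ∀ {n} → ℕ → ℕ → (ℕ → Vecℚ n) → Vecℚ n
sumFromTo a b f = go (suc b ∸ a) a
  where
  go : ℕ → ℕ → _
  go zero    i = zeroV
  go (suc c) i = f i +V go c (suc i)

-- Work with 0-based j, l and coordinates k : Fin (p+q).  The coordinate k of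
-- e_j^p · e_l^q is the number of (p,q)-shuffles ι with w_ι = u_k, where u_k
-- is the tubing whose only non-singleton node is k.  For a shuffle ι one
-- has w_ι = u_{ι(p+l)} (`wTub-tub`), so we count the shuffles with
-- ι(p+l) = k.
--
-- A shuffle is encoded by a lattice path with p left and q right steps,
-- recording for every position of [p+q] which block it receives a value
-- from.  `decode` turns paths into shuffles injectively and every shuffle is
-- decoded from a path (`shuffle-decoded`, by peeling off the smallest value),
-- so coordinate k counts the paths whose l-th right step is at position k
-- (`multiplicity-as-path-count`).  Splitting paths by their first step gives
-- a Pascal recursion proving that this number is C(k,l)·C(p+q-1-k, q-1-l)
-- (`pathsThrough-formula`).  Finally, the k-th coordinate of the sum on the
-- right-hand side is its single term i = k+1 (`sumRange-single`).

module Submission where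

open import Defs
open import Data.Nat using (ℕ; _+_; _*_; _∸_; suc)
open import Data.Nat.Combinatorics using (_C_)
open import Data.Fin using (Fin; toℕ)
open import Relation.Binary.PropositionalEquality using (_≡_)

open import Data.Nat as ℕ using (zero; z≤n; s≤s; _≤_; _<_; _≟_)
open import Data.Nat.Properties as ℕP
  using (+-suc; +-identityʳ; suc-injective; <-irrefl; ≤-refl; <⇒≤; ≤∧≢⇒<)
open import Data.Nat.Combinatorics using (k>n⇒nCk≡0; nCn≡1; nCk+nC[k+1]≡[n+1]C[k+1])
open import Data.Bool using (true; false; _∨_; not; if_then_else_)
import Data.Bool.Properties as BoolP
open import Data.Fin as F using (_↑ˡ_; _↑ʳ_; splitAt; punchOut; cast)
open import Data.Fin.Properties as FP
  using (toℕ-injective; toℕ<n; toℕ-cast; ↑ʳ-injective; join-splitAt; splitAt-↑ˡ; splitAt-↑ʳ;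
         punchOut-injective; injective⇒≤; any?)
open import Data.Fin.Subset using (⁅_⁆)
open import Data.Fin.Subset.Properties using (x∈⁅x⁆; x≢y⇒x∉⁅y⁆; x∉p⇒x∈∁p)
open import Data.Vec as V using (Vec; []; _∷_; lookup; tabulate)
open import Data.Vec.Properties as VP
  using (lookup-map; []=⇒lookup; lookup-++ˡ; lookup-++ʳ; lookup∘tabulate; tabulate∘lookup;
         tabulate-cong; ∷-injectiveˡ; ∷-injectiveʳ)
open import Data.List using (List; []; _∷_; map; filter; length; _++_)
open import Data.List.Properties using (length-map; length-++; filter-++; filter-all; filter-none; filter-≐)
open import Data.List.Membership.Propositional using (_∈_)
open import Data.List.Membership.Propositional.Properties
  using (∈-map⁺; ∈-map⁻; ∈-++⁺ˡ; ∈-++⁺ʳ; ∈-filter⁺; ∈-filter⁻; ∈-concatMap⁺; ∈-allFin)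
open import Data.List.Membership.Propositional.Properties.WithK using (unique∧set⇒bag)
open import Data.List.Relation.Binary.BagAndSetEquality using (∼bag⇒↭)
open import Data.List.Relation.Binary.Permutation.Propositional.Properties using (↭-length)
open import Data.List.Relation.Binary.Disjoint.Propositional using (Disjoint)
open import Data.List.Relation.Unary.Any as Any using (here)
import Data.List.Relation.Unary.All as All
import Data.List.Relation.Unary.All.Properties as AllP
import Data.List.Relation.Unary.AllPairs as AllPairs
import Data.List.Relation.Unary.AllPairs.Properties as AllPairsP
open import Data.List.Relation.Unary.Unique.Propositional using (Unique)
import Data.List.Relation.Unary.Unique.Propositional.Properties as UniqueP
open import Data.Rational using (ℚ; 0ℚ) renaming (_+_ to _+ℚ_; _*_ to _*ℚ_)
import Data.Rational.Properties as ℚP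
open import Data.Product using (∃; _×_; _,_; proj₁; proj₂)
open import Data.Sum using (_⊎_; inj₁; inj₂) renaming (swap to ⊎-swap; map to ⊎-map)
open import Data.Empty using (⊥-elim)
open import Function.Bundles using (mk⇔)
open import Relation.Nullary using (Dec; yes; no; ¬_; does)
open import Relation.Nullary.Decidable using (dec-true; dec-false; decidable-stable; _×-dec_)
open import Relation.Unary using (Decidable)
open import Relation.Binary.PropositionalEquality
  using (_≢_; refl; sym; trans; cong; cong₂; subst; subst₂; module ≡-Reasoning)

count : {A : Set} {P : A → Set} → Decidable P → List A → ℕ
count P? xs = length (filter P? xs)

count-++ : {A : Set} {P : A → Set} (P? : Decidable P) (xs ys : List A) →
  count P? (xs ++ ys) ≡ count P? xs + count P? ys
count-++ P? xs ys = trans (cong length (filter-++ P? xs ys)) (length-++ (filter P? xs))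

count-map : {A B : Set} {P : B → Set} (P? : Decidable P) (f : A → B) (xs : List A) →
  count P? (map f xs) ≡ count (λ a → P? (f a)) xs
count-map P? f []       = refl
count-map P? f (x ∷ xs) with does (P? (f x))
... | true  = cong suc (count-map P? f xs)
... | false = count-map P? f xs

count-≐ : {A : Set} {P Q : A → Set} (P? : Decidable P) (Q? : Decidable Q) (xs : List A) →
  (∀ a → P a → Q a) → (∀ a → Q a → P a) → count P? xs ≡ count Q? xs
count-≐ P? Q? xs P⇒Q Q⇒P = cong length (filter-≐ P? Q? ((λ {a} → P⇒Q a) , (λ {a} → Q⇒P a)) xs)

count-none : {A : Set} {P : A → Set} (P? : Decidable P) (xs : List A) →
  (∀ a → ¬ P a) → count P? xs ≡ 0
count-none P? xs ¬P = cong length (filter-none P? {xs} (All.tabulate (λ {a} _ → ¬P a)))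

count-all : {A : Set} {P : A → Set} (P? : Decidable P) (xs : List A) →
  (∀ a → P a) → count P? xs ≡ length xs
count-all P? xs allP = cong length (filter-all P? {xs} (All.tabulate (λ {a} _ → allP a)))

count-enumerated : {A : Set} {P : A → Set} (P? : Decidable P) {xs ys : List A} →
  Unique xs → (∀ a → a ∈ xs) → Unique ys →
  (∀ a → P a → a ∈ ys) → (∀ a → a ∈ ys → P a) → count P? xs ≡ length ys
count-enumerated P? {xs} {ys} xs-unique xs-complete ys-unique P⇒∈ ∈⇒P =
  ↭-length (∼bag⇒↭ (unique∧set⇒bag (UniqueP.filter⁺ P? xs-unique) ys-unique (mk⇔ to from)))
  where
  to : ∀ {a} → a ∈ filter P? xs → a ∈ ys
  to {a} a∈ = P⇒∈ a (proj₂ (∈-filter⁻ P? {xs = xs} a∈))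
  from : ∀ {a} → a ∈ ys → a ∈ filter P? xs
  from {a} a∈ = ∈-filter⁺ P? (xs-complete a) (∈⇒P a a∈)

allVecs-complete : ∀ m n (v : Vec (Fin n) m) → v ∈ allVecs m n
allVecs-complete zero    n []      = here refl
allVecs-complete (suc m) n (x ∷ v) =
  ∈-concatMap⁺ (λ y → map (y ∷_) (allVecs m n))
    (Any.map (λ { refl → ∈-map⁺ (x ∷_) (allVecs-complete m n v) }) (∈-allFin x))

allVecs-unique : ∀ m n → Unique (allVecs m n)
allVecs-unique zero    n = All.[] AllPairs.∷ AllPairs.[]
allVecs-unique (suc m) n =
  UniqueP.concat⁺ (AllP.map⁺ (All.tabulate (λ _ → UniqueP.map⁺ ∷-injectiveʳ (allVecs-unique m n))))
                  (AllPairsP.map⁺ (AllPairs.map blocks-disjoint (UniqueP.allFin⁺ n)))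
  where
  blocks-disjoint : ∀ {x y : Fin n} → x ≢ y →
    Disjoint (map (x ∷_) (allVecs m n)) (map (y ∷_) (allVecs m n))
  blocks-disjoint x≢y (∈x , ∈y) with ∈-map⁻ _ ∈x | ∈-map⁻ _ ∈y
  ... | _ , _ , refl | _ , _ , eq = x≢y (∷-injectiveˡ eq)

injective⇒surjective : ∀ {n} (g : Fin n → Fin n) → (∀ {x y} → g x ≡ g y → x ≡ y) →
  ∀ a → ∃ λ c → g c ≡ a
injective⇒surjective {suc m} g g-injective a with any? (λ c → g c F.≟ a)
... | yes hit = hit
... | no  miss = ⊥-elim (<-irrefl refl (injective⇒≤ avoid-a-injective))
  where
  -- g misses a, so g followed by removing a is an injection Fin (1+m) → Fin m
  a≢g : ∀ c → a ≢ g c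
  a≢g c a≡gc = miss (c , sym a≡gc)
  avoid-a-injective : ∀ {x y} → punchOut (a≢g x) ≡ punchOut (a≢g y) → x ≡ y
  avoid-a-injective eq = g-injective (punchOut-injective (a≢g _) (a≢g _) eq)

-- A surjective endomap of Fin n is injective; the shuffles ι of Defs are
-- only required to be surjective.
surjective⇒injective : ∀ {n} (f : Fin n → Fin n) → (∀ k → ∃ λ m → f m ≡ k) →
  ∀ {a b} → f a ≡ f b → a ≡ b
surjective⇒injective {n} f surj {a} {b} fa≡fb =
  trans (section-of-f a) (trans (cong section fa≡fb) (sym (section-of-f b)))
  where
  section : Fin n → Fin n
  section k = proj₁ (surj k)
  section-injective : ∀ {x y} → section x ≡ section y → x ≡ y
  section-injective {x} {y} eq = trans (sym (proj₂ (surj x))) (trans (cong f eq) (proj₂ (surj y)))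
  -- every point is a value of the section, hence fixed by section ∘ f
  section-of-f : ∀ x → x ≡ section (f x)
  section-of-f x with injective⇒surjective section section-injective x
  ... | c , refl = cong section (sym (proj₂ (surj c)))

data Block (p q : ℕ) : Fin (p + q) → Set where
  left  : (a : Fin p) → Block p q (a ↑ˡ q)
  right : (b : Fin q) → Block p q (p ↑ʳ b)

block : ∀ p q (m : Fin (p + q)) → Block p q m
block p q m with splitAt p m | join-splitAt p q m
... | inj₁ a | refl = left a
... | inj₂ b | refl = right b

↑ˡ≢↑ʳ : ∀ {p q} (a : Fin p) (b : Fin q) → a ↑ˡ q ≢ p ↑ʳ b
↑ˡ≢↑ʳ {p} {q} a b eq with trans (sym (splitAt-↑ˡ p a q)) (trans (cong (splitAt p) eq) (splitAt-↑ʳ p q b))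
... | ()

lookup-extensional : ∀ {A : Set} {n} (u v : Vec A n) → (∀ i → lookup u i ≡ lookup v i) → u ≡ v
lookup-extensional u v same =
  trans (sym (tabulate∘lookup u)) (trans (tabulate-cong same) (tabulate∘lookup v))

-- Lattice paths with p left steps and q right steps

-- Read from the start, a path lists the positions 0, 1, …, p+q-1 of a
-- shuffle; a left (right) step means that position receives the next value
-- of the first (second) block.
data Path : ℕ → ℕ → Set where
  done : Path 0 0
  L    : ∀ {p q} → Path p q → Path (suc p) q
  R    : ∀ {p q} → Path p q → Path p (suc q)

allPaths : ∀ p q → List (Path p q)
allPaths zero    zero    = done ∷ []
allPaths (suc p) zero    = map L (allPaths p zero)
allPaths zero    (suc q) = map R (allPaths zero q)
allPaths (suc p) (suc q) = map L (allPaths p (suc q)) ++ map R (allPaths (suc p) q)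

allPaths-complete : ∀ {p q} (w : Path p q) → w ∈ allPaths p q
allPaths-complete done                    = here refl
allPaths-complete {suc p} {zero}  (L w) = ∈-map⁺ L (allPaths-complete w)
allPaths-complete {suc p} {suc q} (L w) = ∈-++⁺ˡ (∈-map⁺ L (allPaths-complete w))
allPaths-complete {zero}  {suc q} (R w) = ∈-map⁺ R (allPaths-complete w)
allPaths-complete {suc p} {suc q} (R w) =
  ∈-++⁺ʳ (map L (allPaths p (suc q))) (∈-map⁺ R (allPaths-complete w))

L-injective : ∀ {p q} {w w′ : Path p q} → L w ≡ L w′ → w ≡ w′
L-injective refl = refl

R-injective : ∀ {p q} {w w′ : Path p q} → R w ≡ R w′ → w ≡ w′
R-injective refl = refl

allPaths-unique : ∀ p q → Unique (allPaths p q)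
allPaths-unique zero    zero    = All.[] AllPairs.∷ AllPairs.[]
allPaths-unique (suc p) zero    = UniqueP.map⁺ L-injective (allPaths-unique p zero)
allPaths-unique zero    (suc q) = UniqueP.map⁺ R-injective (allPaths-unique zero q)
allPaths-unique (suc p) (suc q) =
  UniqueP.++⁺ (UniqueP.map⁺ L-injective (allPaths-unique p (suc q)))
              (UniqueP.map⁺ R-injective (allPaths-unique (suc p) q))
              L-and-R-disjoint
  where
  L-and-R-disjoint : Disjoint (map L (allPaths p (suc q))) (map R (allPaths (suc p) q))
  L-and-R-disjoint (∈L , ∈R) with ∈-map⁻ L ∈L | ∈-map⁻ R ∈R
  ... | _ , _ , refl | _ , _ , ()

allPaths-length : ∀ p q → length (allPaths p q) ≡ (p + q) C q
allPaths-length zero    zero    = refl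
allPaths-length (suc p) zero    = trans (length-map L (allPaths p zero)) (allPaths-length p zero)
allPaths-length zero    (suc q) = begin
  length (map R (allPaths zero q)) ≡⟨ length-map R (allPaths zero q) ⟩
  length (allPaths zero q)         ≡⟨ allPaths-length zero q ⟩
  q C q                            ≡⟨ trans (nCn≡1 q) (sym (nCn≡1 (suc q))) ⟩
  suc q C suc q                    ∎
  where open ≡-Reasoning
allPaths-length (suc p) (suc q) = begin
  length (map L (allPaths p (suc q)) ++ map R (allPaths (suc p) q))
    ≡⟨ length-++ (map L (allPaths p (suc q))) ⟩
  length (map L (allPaths p (suc q))) + length (map R (allPaths (suc p) q))
    ≡⟨ cong₂ _+_ (length-map L (allPaths p (suc q))) (length-map R (allPaths (suc p) q)) ⟩
  length (allPaths p (suc q)) + length (allPaths (suc p) q)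
    ≡⟨ cong₂ _+_ (allPaths-length p (suc q)) (allPaths-length (suc p) q) ⟩
  (p + suc q) C suc q + suc (p + q) C q
    ≡⟨ cong (λ n → (p + suc q) C suc q + n C q) (sym (+-suc p q)) ⟩
  (p + suc q) C suc q + (p + suc q) C q
    ≡⟨ ℕP.+-comm ((p + suc q) C suc q) _ ⟩
  (p + suc q) C q + (p + suc q) C suc q
    ≡⟨ nCk+nC[k+1]≡[n+1]C[k+1] (p + suc q) q ⟩
  suc (p + suc q) C suc q ∎
  where open ≡-Reasoning

-- posL w a / posR w b : the position in [p+q] of the a-th left step /
-- the b-th right step of w (all counted from 0).
posL : ∀ {p q} → Path p q → Fin p → Fin (p + q)
posL (L w) F.zero    = F.zero
posL (L w) (F.suc a) = F.suc (posL w a)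
posL {p} {suc q} (R w) a = cast (sym (+-suc p q)) (F.suc (posL w a))

posR : ∀ {p q} → Path p q → Fin q → Fin (p + q)
posR (L w) b = F.suc (posR w b)
posR {p} {suc q} (R w) F.zero    = cast (sym (+-suc p q)) F.zero
posR {p} {suc q} (R w) (F.suc b) = cast (sym (+-suc p q)) (F.suc (posR w b))

atL : ∀ {p q} → Path p q → Fin p → ℕ
atL w a = toℕ (posL w a)

atR : ∀ {p q} → Path p q → Fin q → ℕ
atR w b = toℕ (posR w b)

atL-R : ∀ {p q} (w : Path p q) a → atL (R w) a ≡ suc (atL w a)
atL-R w a = toℕ-cast _ (F.suc (posL w a))

atR-R-zero : ∀ {p q} (w : Path p q) → atR (R w) F.zero ≡ 0
atR-R-zero {p} {q} w = toℕ-cast _ (F.zero {p + q})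

atR-R-suc : ∀ {p q} (w : Path p q) b → atR (R w) (F.suc b) ≡ suc (atR w b)
atR-R-suc w b = toℕ-cast _ (F.suc (posR w b))

Increasing : ∀ {n} → (Fin n → ℕ) → Set
Increasing X = ∀ a b → a F.< b → X a < X b

atL-increasing : ∀ {p q} (w : Path p q) → Increasing (atL w)
atL-increasing (L w) F.zero    (F.suc b) _          = s≤s z≤n
atL-increasing (L w) (F.suc a) (F.suc b) (s≤s a<b) = s≤s (atL-increasing w a b a<b)
atL-increasing (R w) a         b         a<b        =
  subst₂ _<_ (sym (atL-R w a)) (sym (atL-R w b)) (s≤s (atL-increasing w a b a<b))

atR-increasing : ∀ {p q} (w : Path p q) → Increasing (atR w)
atR-increasing (L w) a         b         a<b        = s≤s (atR-increasing w a b a<b)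
atR-increasing (R w) F.zero    (F.suc b) _          =
  subst₂ _<_ (sym (atR-R-zero w)) (sym (atR-R-suc w b)) (s≤s z≤n)
atR-increasing (R w) (F.suc a) (F.suc b) (s≤s a<b) =
  subst₂ _<_ (sym (atR-R-suc w a)) (sym (atR-R-suc w b)) (s≤s (atR-increasing w a b a<b))

Attained : ∀ {p q} → (Fin p → ℕ) → (Fin q → ℕ) → ℕ → Set
Attained X Y v = (∃ λ a → X a ≡ v) ⊎ (∃ λ b → Y b ≡ v)

positions-cover : ∀ {p q} (w : Path p q) v → v < p + q → Attained (atL w) (atR w) v
positions-cover (L w) zero    _         = inj₁ (F.zero , refl)
positions-cover (L w) (suc v) (s≤s v<) with positions-cover w v v<
... | inj₁ (a , eq) = inj₁ (F.suc a , cong suc eq)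
... | inj₂ (b , eq) = inj₂ (b , cong suc eq)
positions-cover (R w) zero    _         = inj₂ (F.zero , atR-R-zero w)
positions-cover {p} {suc q} (R w) (suc v) v<
  with positions-cover w v (ℕ.s<s⁻¹ (subst (suc v <_) (+-suc p q) v<))
... | inj₁ (a , eq) = inj₁ (a , trans (atL-R w a) (cong suc eq))
... | inj₂ (b , eq) = inj₂ (F.suc b , trans (atR-R-suc w b) (cong suc eq))

positions-determine : ∀ {p q} (w w′ : Path p q) →
  (∀ a → atL w a ≡ atL w′ a) → (∀ b → atR w b ≡ atR w′ b) → w ≡ w′
positions-determine done  done   _    _    = refl
positions-determine (L w) (L w′) same same′ = cong L (positions-determine w w′
  (λ a → suc-injective (same (F.suc a)))
  (λ b → suc-injective (same′ b)))
positions-determine (R w) (R w′) same same′ = cong R (positions-determine w w′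
  (λ a → suc-injective (trans (sym (atL-R w a)) (trans (same a) (atL-R w′ a))))
  (λ b → suc-injective (trans (sym (atR-R-suc w b)) (trans (same′ (F.suc b)) (atR-R-suc w′ b)))))
positions-determine (L w) (R w′) _    same′ with trans (same′ F.zero) (atR-R-zero w′)
... | ()
positions-determine (R w) (L w′) _    same′ with trans (sym (atR-R-zero w)) (same′ F.zero)
... | ()

decode : ∀ {p q} → Path p q → Perm (p + q)
decode w = tabulate (posL w) V.++ tabulate (posR w)

decode-↑ˡ : ∀ {p q} (w : Path p q) a → lookup (decode w) (a ↑ˡ q) ≡ posL w a
decode-↑ˡ w a = trans (lookup-++ˡ (tabulate (posL w)) (tabulate (posR w)) a) (lookup∘tabulate (posL w) a)

decode-↑ʳ : ∀ {p q} (w : Path p q) b → lookup (decode w) (p ↑ʳ b) ≡ posR w b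
decode-↑ʳ w b = trans (lookup-++ʳ (tabulate (posL w)) (tabulate (posR w)) b) (lookup∘tabulate (posR w) b)

decode-shuffle : ∀ {p q} (w : Path p q) → IsShuffle p q (decode w)
decode-shuffle {p} {q} w = onto , increasingˡ , increasingʳ
  where
  onto : IsPerm (decode w)
  onto k with positions-cover w (toℕ k) (toℕ<n k)
  ... | inj₁ (a , eq) = a ↑ˡ q , toℕ-injective (trans (cong toℕ (decode-↑ˡ w a)) eq)
  ... | inj₂ (b , eq) = p ↑ʳ b , toℕ-injective (trans (cong toℕ (decode-↑ʳ w b)) eq)
  increasingˡ : ∀ a b → a F.< b → lookup (decode w) (a ↑ˡ q) F.< lookup (decode w) (b ↑ˡ q)
  increasingˡ a b a<b =
    subst₂ F._<_ (sym (decode-↑ˡ w a)) (sym (decode-↑ˡ w b)) (atL-increasing w a b a<b)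
  increasingʳ : ∀ a b → a F.< b → lookup (decode w) (p ↑ʳ a) F.< lookup (decode w) (p ↑ʳ b)
  increasingʳ a b a<b =
    subst₂ F._<_ (sym (decode-↑ʳ w a)) (sym (decode-↑ʳ w b)) (atR-increasing w a b a<b)

decode-injective : ∀ {p q} {w w′ : Path p q} → decode w ≡ decode w′ → w ≡ w′
decode-injective {p} {q} {w} {w′} eq = positions-determine w w′
  (λ a → cong toℕ (trans (sym (decode-↑ˡ w a)) (trans (cong (λ ι → lookup ι (a ↑ˡ q)) eq) (decode-↑ˡ w′ a))))
  (λ b → cong toℕ (trans (sym (decode-↑ʳ w b)) (trans (cong (λ ι → lookup ι (p ↑ʳ b)) eq) (decode-↑ʳ w′ b))))

-- Every shuffle is encoded by a path

-- Increasing X, Y with disjoint values exhausting the interval [o, o+p+q):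
-- the values of the two blocks of a shuffle, once o values are consumed.
record Interleaving {p q} (o : ℕ) (X : Fin p → ℕ) (Y : Fin q → ℕ) : Set where
  field
    X-increasing : Increasing X
    Y-increasing : Increasing Y
    X-bounded    : ∀ a → o ≤ X a
    Y-bounded    : ∀ b → o ≤ Y b
    disjoint     : ∀ a b → X a ≢ Y b
    exhaustive   : ∀ v → o ≤ v → v < o + (p + q) → Attained X Y v

swap-blocks : ∀ {p q o} {X : Fin p → ℕ} {Y : Fin q → ℕ} → Interleaving o X Y → Interleaving o Y X
swap-blocks {p} {q} {o} I = record
  { X-increasing = Y-increasing
  ; Y-increasing = X-increasing
  ; X-bounded    = Y-bounded
  ; Y-bounded    = X-bounded
  ; disjoint     = λ b a eq → disjoint a b (sym eq)
  ; exhaustive   = λ v o≤v v< → ⊎-swap (exhaustive v o≤v (subst (v <_) o+q+p≡o+p+q v<))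
  }
  where
  open Interleaving I
  o+q+p≡o+p+q : o + (q + p) ≡ o + (p + q)
  o+q+p≡o+p+q = cong (o +_) (ℕP.+-comm q p)

attains-first : ∀ {p o} {X : Fin (suc p) → ℕ} → Increasing X → (∀ a → o ≤ X a) →
  ∀ a → X a ≡ o → X F.zero ≡ o
attains-first X-inc X-bnd F.zero    eq = eq
attains-first X-inc X-bnd (F.suc a) eq =
  ℕP.≤-antisym (subst (_ ≤_) eq (<⇒≤ (X-inc F.zero (F.suc a) (s≤s z≤n)))) (X-bnd F.zero)

drop-first : ∀ {p q o} {X : Fin (suc p) → ℕ} {Y : Fin q → ℕ} →
  Interleaving o X Y → X F.zero ≡ o → Interleaving (suc o) (λ a → X (F.suc a)) Y
drop-first {p} {q} {o} {X} {Y} I X₀≡o = record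
  { X-increasing = λ a b a<b → X-increasing (F.suc a) (F.suc b) (s≤s a<b)
  ; Y-increasing = Y-increasing
  ; X-bounded    = λ a → subst (_< X (F.suc a)) X₀≡o (X-increasing F.zero (F.suc a) (s≤s z≤n))
  ; Y-bounded    = λ b → ≤∧≢⇒< (Y-bounded b) (λ o≡Yb → disjoint F.zero b (trans X₀≡o o≡Yb))
  ; disjoint     = λ a → disjoint (F.suc a)
  ; exhaustive   = exhaustive′
  }
  where
  open Interleaving I
  exhaustive′ : ∀ v → suc o ≤ v → v < suc o + (p + q) → Attained (λ a → X (F.suc a)) Y v
  exhaustive′ v o<v v< with exhaustive v (<⇒≤ o<v) (subst (v <_) (sym (+-suc o (p + q))) v<)
  ... | inj₁ (F.zero , X₀≡v)  = ⊥-elim (<-irrefl (trans (sym X₀≡o) X₀≡v) o<v)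
  ... | inj₁ (F.suc a , eq)   = inj₁ (a , eq)
  ... | inj₂ attained         = inj₂ attained

Realises : ∀ {p q} → ℕ → (Fin p → ℕ) → (Fin q → ℕ) → Set
Realises {p} {q} o X Y = ∃ λ (w : Path p q) → (∀ a → X a ≡ o + atL w a) × (∀ b → Y b ≡ o + atR w b)

prepend-L : ∀ {p q o} {X : Fin (suc p) → ℕ} {Y : Fin q → ℕ} →
  X F.zero ≡ o → Realises (suc o) (λ a → X (F.suc a)) Y → Realises o X Y
prepend-L {o = o} {X} {Y} X₀≡o (w , Xs , Ys) = L w , X-real , λ b → trans (Ys b) (sym (+-suc o _))
  where
  X-real : ∀ a → X a ≡ o + atL (L w) a
  X-real F.zero    = trans X₀≡o (sym (+-identityʳ o))
  X-real (F.suc a) = trans (Xs a) (sym (+-suc o _))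

prepend-R : ∀ {p q o} {X : Fin p → ℕ} {Y : Fin (suc q) → ℕ} →
  Y F.zero ≡ o → Realises (suc o) X (λ b → Y (F.suc b)) → Realises o X Y
prepend-R {o = o} {X} {Y} Y₀≡o (w , Xs , Ys) = R w , X-real , Y-real
  where
  X-real : ∀ a → X a ≡ o + atL (R w) a
  X-real a = trans (Xs a) (trans (sym (+-suc o _)) (cong (o +_) (sym (atL-R w a))))
  Y-real : ∀ b → Y b ≡ o + atR (R w) b
  Y-real F.zero    = trans Y₀≡o (trans (sym (+-identityʳ o)) (cong (o +_) (sym (atR-R-zero w))))
  Y-real (F.suc b) = trans (Ys b) (trans (sym (+-suc o _)) (cong (o +_) (sym (atR-R-suc w b))))

-- Every interleaving is realised by a path: the least value o is taken by
-- one of the blocks, which fixes the first step; recurse on the rest.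
mutual
  realise : ∀ {p q o} {X : Fin p → ℕ} {Y : Fin q → ℕ} → Interleaving o X Y → Realises o X Y
  realise {zero}  {zero}          I = done , (λ ()) , (λ ())
  realise {suc p} {q}     {o}     I =
    realise-from I (Interleaving.exhaustive I o ≤-refl (ℕP.m<m+n o ℕP.0<1+n))
  realise {zero}  {suc q} {o}     I =
    realise-from I (Interleaving.exhaustive I o ≤-refl (ℕP.m<m+n o ℕP.0<1+n))

  realise-from : ∀ {p q o} {X : Fin p → ℕ} {Y : Fin q → ℕ} →
    Interleaving o X Y → Attained X Y o → Realises o X Y
  realise-from {suc p} {o = o} {X} I (inj₁ (a , Xa≡o)) = prepend-L X₀≡o (realise (drop-first I X₀≡o))
    where
    X₀≡o : X F.zero ≡ o
    X₀≡o = attains-first (Interleaving.X-increasing I) (Interleaving.X-bounded I) a Xa≡o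
  realise-from {q = suc q} {o} {Y = Y} I (inj₂ (b , Yb≡o)) =
    prepend-R Y₀≡o (realise (swap-blocks (drop-first (swap-blocks I) Y₀≡o)))
    where
    Y₀≡o : Y F.zero ≡ o
    Y₀≡o = attains-first (Interleaving.Y-increasing I) (Interleaving.Y-bounded I) b Yb≡o

-- Every shuffle is the decoding of a path: the values of its two blocks
-- interleave [0, p+q), and the realising path decodes back to it.
shuffle-decoded : ∀ {p q} (ι : Perm (p + q)) → IsShuffle p q ι → ∃ λ (w : Path p q) → ι ≡ decode w
shuffle-decoded {p} {q} ι (onto , increasingˡ , increasingʳ) = w , lookup-extensional ι (decode w) agree
  where
  ι-injective : ∀ {m m′} → lookup ι m ≡ lookup ι m′ → m ≡ m′
  ι-injective = surjective⇒injective (lookup ι) onto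
  X : Fin p → ℕ
  X a = toℕ (lookup ι (a ↑ˡ q))
  Y : Fin q → ℕ
  Y b = toℕ (lookup ι (p ↑ʳ b))
  exhaustive : ∀ v → 0 ≤ v → v < 0 + (p + q) → Attained X Y v
  exhaustive v _ v< with onto (F.fromℕ< v<)
  ... | m , ιm≡v with block p q m
  ...   | left  a = inj₁ (a , trans (cong toℕ ιm≡v) (FP.toℕ-fromℕ< v<))
  ...   | right b = inj₂ (b , trans (cong toℕ ιm≡v) (FP.toℕ-fromℕ< v<))
  interleaving : Interleaving 0 X Y
  interleaving = record
    { X-increasing = increasingˡ
    ; Y-increasing = increasingʳ
    ; X-bounded    = λ _ → z≤n
    ; Y-bounded    = λ _ → z≤n
    ; disjoint     = λ a b eq → ↑ˡ≢↑ʳ a b (ι-injective (toℕ-injective eq))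
    ; exhaustive   = exhaustive
    }
  realisation : Realises 0 X Y
  realisation = realise interleaving
  w : Path p q
  w = proj₁ realisation
  agree : ∀ m → lookup ι m ≡ lookup (decode w) m
  agree m with block p q m
  ... | left  a = toℕ-injective (trans (proj₁ (proj₂ realisation) a) (sym (cong toℕ (decode-↑ˡ w a))))
  ... | right b = toℕ-injective (trans (proj₂ (proj₂ realisation) b) (sym (cong toℕ (decode-↑ʳ w b))))

tub-self : ∀ {n} (k : Fin n) → lookup (tub k) k ≡ false
tub-self k = trans (lookup-map k not ⁅ k ⁆) (cong not ([]=⇒lookup (x∈⁅x⁆ k)))

tub-other : ∀ {n} {k m : Fin n} → m ≢ k → lookup (tub k) m ≡ true
tub-other m≢k = []=⇒lookup (x∉p⇒x∈∁p (x≢y⇒x∉⁅y⁆ m≢k))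

tub-true⇒≢ : ∀ {n} {k m : Fin n} → lookup (tub k) m ≡ true → m ≢ k
tub-true⇒≢ {k = k} m∈ refl with trans (sym m∈) (tub-self k)
... | ()

tub-injective : ∀ {n} {k k′ : Fin n} → tub k ≡ tub k′ → k ≡ k′
tub-injective {k = k} {k′} eq = decidable-stable (k F.≟ k′)
  (λ k≢k′ → tub-true⇒≢ {k = k} (trans (cong (λ t → lookup t k) eq) (tub-other k≢k′)) refl)

module _ (p q : ℕ) (ι : Perm (p + q)) (v : Tubing q) where

  private
    firstBlock? : (m : Fin (p + q)) → Dec (∃ λ (a : Fin p) → lookup ι (a ↑ˡ q) ≡ m)
    firstBlock? m = any? (λ a → lookup ι (a ↑ˡ q) F.≟ m)
    secondBlock? : (m : Fin (p + q)) →
      Dec (∃ λ (b : Fin q) → (lookup v b ≡ true) × (lookup ι (p ↑ʳ b) ≡ m))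
    secondBlock? m = any? (λ b → (lookup v b BoolP.≟ true) ×-dec (lookup ι (p ↑ʳ b) F.≟ m))
    wTub-lookup : ∀ m → lookup (wTub p q ι v) m ≡ does (firstBlock? m) ∨ does (secondBlock? m)
    wTub-lookup m = lookup∘tabulate _ m

  wTub-first : ∀ m a → lookup ι (a ↑ˡ q) ≡ m → lookup (wTub p q ι v) m ≡ true
  wTub-first m a eq =
    trans (wTub-lookup m) (cong (_∨ does (secondBlock? m)) (dec-true (firstBlock? m) (a , eq)))

  wTub-second : ∀ m b → lookup v b ≡ true → lookup ι (p ↑ʳ b) ≡ m → lookup (wTub p q ι v) m ≡ true
  wTub-second m b b∈v eq = trans (wTub-lookup m)
    (trans (cong (does (firstBlock? m) ∨_) (dec-true (secondBlock? m) (b , b∈v , eq))) (BoolP.∨-zeroʳ _))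

  wTub-neither : ∀ m → (∀ a → lookup ι (a ↑ˡ q) ≢ m) →
    (∀ b → lookup v b ≡ true → lookup ι (p ↑ʳ b) ≢ m) → lookup (wTub p q ι v) m ≡ false
  wTub-neither m not-first not-second = trans (wTub-lookup m) (cong₂ _∨_
    (dec-false (firstBlock? m) (λ (a , eq) → not-first a eq))
    (dec-false (secondBlock? m) (λ (b , b∈v , eq) → not-second b b∈v eq)))

-- For a shuffle ι, w_ι built from u_l is u_{ι(p+l)}: every node but ι(p+l)
-- is the image of a singleton tube.
wTub-tub : ∀ p q (ι : Perm (p + q)) → IsShuffle p q ι → (l : Fin q) →
  wTub p q ι (tub l) ≡ tub (lookup ι (p ↑ʳ l))
wTub-tub p q ι (onto , _) l = lookup-extensional _ _ pointwise
  where
  ι-injective : ∀ {m m′} → lookup ι m ≡ lookup ι m′ → m ≡ m′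
  ι-injective = surjective⇒injective (lookup ι) onto
  pointwise : ∀ m → lookup (wTub p q ι (tub l)) m ≡ lookup (tub (lookup ι (p ↑ʳ l))) m
  pointwise m with m F.≟ lookup ι (p ↑ʳ l)
  ... | yes refl = trans
          (wTub-neither p q ι (tub l) m
            (λ a eq → ↑ˡ≢↑ʳ a l (ι-injective eq))
            (λ b b∈ eq → tub-true⇒≢ b∈ (↑ʳ-injective p b l (ι-injective eq))))
          (sym (tub-self m))
  ... | no m≢ with onto m
  ...   | m′ , ιm′≡m with block p q m′
  ...     | left a  = trans (wTub-first p q ι (tub l) m a ιm′≡m) (sym (tub-other m≢))
  ...     | right b with b F.≟ l
  ...       | yes refl = ⊥-elim (m≢ (sym ιm′≡m))
  ...       | no b≢l   = trans (wTub-second p q ι (tub l) m b (tub-other b≢l) ιm′≡m) (sym (tub-other m≢))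

-- The coefficient counts paths

through : ∀ {p q} → List (Path p q) → Fin q → ℕ → ℕ
through ws b v = count (λ w → atR w b ≟ v) ws

pathsThrough : ∀ p q → Fin q → ℕ → ℕ
pathsThrough p q = through (allPaths p q)

-- The coefficient of e_{k+1} in e_j^p · e_l^q is the number of paths whose
-- l-th right step is at position k: the shuffles ι with w_ι = u_k are the
-- decodings of exactly these paths.
multiplicity-as-path-count : ∀ p q (j : Fin p) (l : Fin q) (k : Fin (p + q)) →
  prodMult (tub j) (tub l) (tub k) ≡ pathsThrough p q l (toℕ k)
multiplicity-as-path-count p q j l k =
  trans (count-enumerated _ (allVecs-unique _ _) (allVecs-complete _ _)
          (UniqueP.map⁺ decode-injective (UniqueP.filter⁺ at-k? (allPaths-unique p q)))
          to from)
        (length-map decode good)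
  where
  at-k? : (w : Path p q) → Dec (atR w l ≡ toℕ k)
  at-k? w = atR w l ≟ toℕ k
  good : List (Path p q)
  good = filter at-k? (allPaths p q)
  lands-at-k : ∀ w → atR w l ≡ toℕ k → wTub p q (decode w) (tub l) ≡ tub k
  lands-at-k w eq = trans (wTub-tub p q (decode w) (decode-shuffle w) l)
    (cong tub (toℕ-injective (trans (cong toℕ (decode-↑ʳ w l)) eq)))
  to : ∀ ι → IsShuffle p q ι × wTub p q ι (tub l) ≡ tub k → ι ∈ map decode good
  to ι (shuffle , w-ι≡u-k) with shuffle-decoded ι shuffle
  ... | w , refl = ∈-map⁺ decode (∈-filter⁺ at-k? (allPaths-complete w)
        (trans (cong toℕ (sym (decode-↑ʳ w l)))
               (cong toℕ (tub-injective (trans (sym (wTub-tub p q (decode w) shuffle l)) w-ι≡u-k)))))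
  from : ∀ ι → ι ∈ map decode good → IsShuffle p q ι × wTub p q ι (tub l) ≡ tub k
  from ι ι∈ with ∈-map⁻ decode ι∈
  ... | w , w∈ , refl = decode-shuffle w , lands-at-k w (proj₂ (∈-filter⁻ at-k? {xs = allPaths p q} w∈))

module _ {p q : ℕ} (ws : List (Path p q)) where

  through-L-zero : ∀ b → through (map L ws) b 0 ≡ 0
  through-L-zero b = trans (count-map _ L ws) (count-none _ ws (λ w ()))

  through-L-suc : ∀ b v → through (map L ws) b (suc v) ≡ through ws b v
  through-L-suc b v = trans (count-map _ L ws)
    (count-≐ _ _ ws (λ w → suc-injective) (λ w → cong suc))

  through-R-first-zero : through (map R ws) F.zero 0 ≡ length ws
  through-R-first-zero = trans (count-map _ R ws) (count-all _ ws atR-R-zero)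

  through-R-first-suc : ∀ v → through (map R ws) F.zero (suc v) ≡ 0
  through-R-first-suc v = trans (count-map _ R ws)
    (count-none _ ws (λ w eq → ℕP.0≢1+n (trans (sym (atR-R-zero w)) eq)))

  through-R-later-zero : ∀ b → through (map R ws) (F.suc b) 0 ≡ 0
  through-R-later-zero b = trans (count-map _ R ws)
    (count-none _ ws (λ w eq → ℕP.1+n≢0 (trans (sym (atR-R-suc w b)) eq)))

  through-R-later-suc : ∀ b v → through (map R ws) (F.suc b) (suc v) ≡ through ws b v
  through-R-later-suc b v = trans (count-map _ R ws) (count-≐ _ _ ws
    (λ w eq → suc-injective (trans (sym (atR-R-suc w b)) eq))
    (λ w eq → trans (atR-R-suc w b) (cong suc eq)))

pascal-scaled : ∀ v b S → (v C suc b) * S + (v C b) * S ≡ (suc v C suc b) * S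
pascal-scaled v b S = trans (sym (ℕP.*-distribʳ-+ S (v C suc b) (v C b)))
  (cong (_* S) (trans (ℕP.+-comm (v C suc b) (v C b)) (nCk+nC[k+1]≡[n+1]C[k+1] v b)))

-- For v, b < q, either v < b+1 or q-1-v < q-1-b, so this product vanishes.
binomials-vanish : ∀ q b v → v < q → (v C suc b) * ((q ∸ suc v) C (q ∸ suc b)) ≡ 0
binomials-vanish q b v v<q with v ℕP.≤? b
... | yes v≤b = cong (_* ((q ∸ suc v) C (q ∸ suc b))) (k>n⇒nCk≡0 (s≤s v≤b))
... | no  v≰b = trans (cong ((v C suc b) *_) (k>n⇒nCk≡0 (ℕP.∸-monoʳ-< (s≤s (ℕP.≰⇒> v≰b)) v<q)))
                      (ℕP.*-zeroʳ (v C suc b))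

binomials-vanish-outside : ∀ p q b v → v < p + q → v < b ⊎ b + suc p ≤ v →
  (v C b) * ((p + q ∸ suc v) C (q ∸ suc b)) ≡ 0
binomials-vanish-outside p q b v _  (inj₁ v<b)     =
  cong (_* ((p + q ∸ suc v) C (q ∸ suc b))) (k>n⇒nCk≡0 v<b)
binomials-vanish-outside p q b v v< (inj₂ b+p<v) =
  trans (cong ((v C b) *_) (k>n⇒nCk≡0 second<)) (ℕP.*-zeroʳ (v C b))
  where
  p+b<v : p + suc b ≤ v
  p+b<v = subst (_≤ v) (trans (ℕP.+-comm b (suc p)) (sym (+-suc p b))) b+p<v
  -- q-1-v < q-1-b, computed inside p+q
  second< : p + q ∸ suc v < q ∸ suc b
  second< = subst (p + q ∸ suc v <_) (ℕP.[m+n]∸[m+o]≡n∸o p q (suc b)) (ℕP.∸-monoʳ-< (s≤s p+b<v) v<)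

-- Without left steps the only path is R^q, whose b-th right step is at
-- position b; the formula below then reads C(v,b)·C(q-1-v, q-1-b) = [v = b].
pathsThrough-no-left : ∀ q (b : Fin q) v → v < q →
  pathsThrough zero q b v ≡ (v C toℕ b) * ((q ∸ suc v) C (q ∸ suc (toℕ b)))
pathsThrough-no-left (suc q) F.zero zero _ = begin
  through (map R (allPaths zero q)) F.zero 0 ≡⟨ through-R-first-zero (allPaths zero q) ⟩
  length (allPaths zero q)                   ≡⟨ allPaths-length zero q ⟩
  q C q                                      ≡⟨ sym (ℕP.*-identityˡ (q C q)) ⟩
  1 * (q C q)                                ∎
  where open ≡-Reasoning
pathsThrough-no-left (suc q) F.zero (suc v) v< = begin
  through (map R (allPaths zero q)) F.zero (suc v) ≡⟨ through-R-first-suc (allPaths zero q) v ⟩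
  0                                                ≡⟨ sym (k>n⇒nCk≡0 (ℕP.∸-monoʳ-< (s≤s z≤n) (ℕ.s≤s⁻¹ v<))) ⟩
  (q ∸ suc v) C q                                  ≡⟨ sym (ℕP.*-identityˡ _) ⟩
  1 * ((q ∸ suc v) C q)                            ∎
  where open ≡-Reasoning
pathsThrough-no-left (suc q) (F.suc b) zero _ = through-R-later-zero (allPaths zero q) b
pathsThrough-no-left (suc q) (F.suc b) (suc v) v< = begin
  through (map R (allPaths zero q)) (F.suc b) (suc v)  ≡⟨ through-R-later-suc (allPaths zero q) b v ⟩
  pathsThrough zero q b v                              ≡⟨ pathsThrough-no-left q b v (ℕ.s≤s⁻¹ v<) ⟩
  0 + (v C toℕ b) * S                                  ≡⟨ cong (_+ (v C toℕ b) * S)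
                                                             (sym (binomials-vanish q (toℕ b) v (ℕ.s≤s⁻¹ v<))) ⟩
  (v C suc (toℕ b)) * S + (v C toℕ b) * S              ≡⟨ pascal-scaled v (toℕ b) S ⟩
  (suc v C suc (toℕ b)) * S                            ∎
  where
  open ≡-Reasoning
  S : ℕ
  S = (q ∸ suc v) C (q ∸ suc (toℕ b))

-- The number of paths whose b-th right step is at position v < p+q: the
-- first v steps contain exactly b right steps, the last p+q-1-v steps
-- exactly q-1-b.
pathsThrough-formula : ∀ p q (b : Fin q) v → v < p + q →
  pathsThrough p q b v ≡ (v C toℕ b) * ((p + q ∸ suc v) C (q ∸ suc (toℕ b)))
pathsThrough-formula zero    q       b v v< = pathsThrough-no-left q b v v<
pathsThrough-formula (suc p) (suc q) b v v< =
  trans (count-++ _ (map L left-first) (map R right-first)) (by-first-step b v v<)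
  where
  left-first : List (Path p (suc q))
  left-first = allPaths p (suc q)
  right-first : List (Path (suc p) q)
  right-first = allPaths (suc p) q
  by-first-step : ∀ b v → v < suc p + suc q →
    through (map L left-first) b v + through (map R right-first) b v
      ≡ (v C toℕ b) * ((suc p + suc q ∸ suc v) C (suc q ∸ suc (toℕ b)))
  by-first-step F.zero zero _ = begin
    through (map L left-first) F.zero 0 + through (map R right-first) F.zero 0
      ≡⟨ cong₂ _+_ (through-L-zero left-first F.zero) (through-R-first-zero right-first) ⟩
    length right-first                ≡⟨ allPaths-length (suc p) q ⟩
    suc (p + q) C q                   ≡⟨ cong (_C q) (sym (+-suc p q)) ⟩
    (p + suc q) C q                   ≡⟨ sym (ℕP.*-identityˡ _) ⟩
    1 * ((p + suc q) C q)             ∎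
    where open ≡-Reasoning
  by-first-step (F.suc b) zero _ =
    cong₂ _+_ (through-L-zero left-first (F.suc b)) (through-R-later-zero right-first b)
  by-first-step F.zero (suc v) v< = begin
    through (map L left-first) F.zero (suc v) + through (map R right-first) F.zero (suc v)
      ≡⟨ cong₂ _+_ (through-L-suc left-first F.zero v) (through-R-first-suc right-first v) ⟩
    pathsThrough p (suc q) F.zero v + 0
      ≡⟨ +-identityʳ _ ⟩
    pathsThrough p (suc q) F.zero v
      ≡⟨ pathsThrough-formula p (suc q) F.zero v (ℕ.s≤s⁻¹ v<) ⟩
    (v C 0) * ((p + suc q ∸ suc v) C q) ∎
    where open ≡-Reasoning
  by-first-step (F.suc b) (suc v) v< = begin
    through (map L left-first) (F.suc b) (suc v) + through (map R right-first) (F.suc b) (suc v)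
      ≡⟨ cong₂ _+_ (through-L-suc left-first (F.suc b) v) (through-R-later-suc right-first b v) ⟩
    pathsThrough p (suc q) (F.suc b) v + pathsThrough (suc p) q b v
      ≡⟨ cong₂ _+_ (pathsThrough-formula p (suc q) (F.suc b) v (ℕ.s≤s⁻¹ v<))
                   (pathsThrough-formula (suc p) q b v (subst (suc v ≤_) (+-suc p q) (ℕ.s≤s⁻¹ v<))) ⟩
    (v C suc (toℕ b)) * S + (v C toℕ b) * ((suc (p + q) ∸ suc v) C (q ∸ suc (toℕ b)))
      ≡⟨ cong (λ n → (v C suc (toℕ b)) * S + (v C toℕ b) * ((n ∸ suc v) C (q ∸ suc (toℕ b))))
              (sym (+-suc p q)) ⟩
    (v C suc (toℕ b)) * S + (v C toℕ b) * S
      ≡⟨ pascal-scaled v (toℕ b) S ⟩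
    (suc v C suc (toℕ b)) * S ∎
    where
    open ≡-Reasoning
    S : ℕ
    S = (p + suc q ∸ suc v) C (q ∸ suc (toℕ b))

sumRange : ∀ {n} → (ℕ → Vecℚ n) → ℕ → ℕ → Fin n → ℚ
sumRange f zero    a k = 0ℚ
sumRange f (suc c) a k = f a k +ℚ sumRange f c (suc a) k

-- Σ_{i=a}^{b} has suc b ∸ a terms.
terms-after-first : ∀ a b c → suc b ∸ a ≡ suc c → b ∸ a ≡ c
terms-after-first zero    b       c eq = suc-injective eq
terms-after-first (suc a) zero    c eq = ⊥-elim (ℕP.0≢1+n (trans (sym (ℕP.0∸n≡0 a)) eq))
terms-after-first (suc a) (suc b) c eq = terms-after-first a b c eq

-- sumFromTo runs its summation loop for suc b ∸ a steps; rewriting that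
-- length to c makes it unfold in step with sumRange.
sumFromTo-sumRange : ∀ {n} (f : ℕ → Vecℚ n) c a b → suc b ∸ a ≡ c → ∀ k →
  sumFromTo a b f k ≡ sumRange f c a k
sumFromTo-sumRange f zero    a b eq k rewrite eq = refl
sumFromTo-sumRange f (suc c) a b eq k rewrite eq | sym (terms-after-first a b c eq) =
  cong (f a k +ℚ_) (sumFromTo-sumRange f (b ∸ a) (suc a) b refl k)

module _ {n} (f : ℕ → Vecℚ n) (k : Fin n) (t : ℕ) (off-t : ∀ i → i ≢ t → f i k ≡ 0ℚ) where

  sumRange-beyond : ∀ c a → t < a → sumRange f c a k ≡ 0ℚ
  sumRange-beyond zero    a t<a = refl
  sumRange-beyond (suc c) a t<a = begin
    f a k +ℚ sumRange f c (suc a) k ≡⟨ cong₂ _+ℚ_ (off-t a (ℕP.>⇒≢ t<a))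
                                                    (sumRange-beyond c (suc a) (ℕP.m<n⇒m<1+n t<a)) ⟩
    0ℚ +ℚ 0ℚ                        ≡⟨ ℚP.+-identityˡ 0ℚ ⟩
    0ℚ                              ∎
    where open ≡-Reasoning

  sumRange-single : ∀ c a → (t < a ⊎ a + c ≤ t → f t k ≡ 0ℚ) → sumRange f c a k ≡ f t k
  sumRange-single zero a outside-vanishes with ℕP.<-≤-connex t a
  ... | inj₁ t<a = sym (outside-vanishes (inj₁ t<a))
  ... | inj₂ a≤t = sym (outside-vanishes (inj₂ (subst (_≤ t) (sym (+-identityʳ a)) a≤t)))
  sumRange-single (suc c) a outside-vanishes with a ≟ t
  ... | yes refl = trans (cong (f a k +ℚ_) (sumRange-beyond c (suc a) ≤-refl)) (ℚP.+-identityʳ (f a k))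
  ... | no  a≢t  = trans (cong₂ _+ℚ_ (off-t a a≢t) (sumRange-single c (suc a) still-outside))
                         (ℚP.+-identityˡ (f t k))
    where
    still-outside : t < suc a ⊎ suc a + c ≤ t → f t k ≡ 0ℚ
    still-outside (inj₁ t<1+a) = outside-vanishes (inj₁ (≤∧≢⇒< (ℕ.s≤s⁻¹ t<1+a) (λ t≡a → a≢t (sym t≡a))))
    still-outside (inj₂ a+1+c≤t) = outside-vanishes (inj₂ (subst (_≤ t) (sym (+-suc a c)) a+1+c≤t))

basis-off : ∀ {N} x i (k : Fin N) → i ≢ suc (toℕ k) → (x •V e N i) k ≡ 0ℚ
basis-off x i k i≢ =
  trans (cong (λ b → x *ℚ (if b then fromℕℚ 1 else 0ℚ)) (dec-false (suc (toℕ k) ≟ i) (λ eq → i≢ (sym eq))))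
        (ℚP.*-zeroʳ x)

basis-on : ∀ {N} x (k : Fin N) → (x •V e N (suc (toℕ k))) k ≡ x
basis-on x k =
  trans (cong (λ b → x *ℚ (if b then fromℕℚ 1 else 0ℚ)) (dec-true (suc (toℕ k) ≟ suc (toℕ k)) refl))
        (ℚP.*-identityʳ x)

theorem7p7 : (p q : ℕ) (j : Fin p) (l : Fin q) →
    ∀ (k : Fin (p + q)) →
      eProd j l k
        ≡ sumFromTo (suc (toℕ l)) (p + suc (toℕ l))
            (λ i → fromℕℚ (((i ∸ 1) C (suc (toℕ l) ∸ 1)) * ((p + q ∸ i) C (q ∸ suc (toℕ l))))
                   •V e (p + q) i)
            k
theorem7p7 p q j l k = begin
  fromℕℚ (prodMult (tub j) (tub l) (tub k))  ≡⟨ cong fromℕℚ (multiplicity-as-path-count p q j l k) ⟩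
  fromℕℚ (pathsThrough p q l k′)             ≡⟨ cong fromℕℚ (pathsThrough-formula p q l k′ (toℕ<n k)) ⟩
  fromℕℚ (coefficient (suc k′))              ≡⟨ sym (basis-on (fromℕℚ (coefficient (suc k′))) k) ⟩
  term (suc k′) k
    ≡⟨ sym (sumRange-single term k (suc k′) term-off (suc p) (suc l′) outside) ⟩
  sumRange term (suc p) (suc l′) k           ≡⟨ sym (sumFromTo-sumRange term (suc p) _ _ number-of-terms k) ⟩
  sumFromTo (suc l′) (p + suc l′) term k     ∎
  where
  open ≡-Reasoning
  k′ l′ : ℕ
  k′ = toℕ k
  l′ = toℕ l
  coefficient : ℕ → ℕ
  coefficient i = ((i ∸ 1) C (suc l′ ∸ 1)) * ((p + q ∸ i) C (q ∸ suc l′))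
  term : ℕ → Vecℚ (p + q)
  term i = fromℕℚ (coefficient i) •V e (p + q) i
  term-off : ∀ i → i ≢ suc k′ → term i k ≡ 0ℚ
  term-off i = basis-off (fromℕℚ (coefficient i)) i k
  outside : suc k′ < suc l′ ⊎ suc l′ + suc p ≤ suc k′ → term (suc k′) k ≡ 0ℚ
  outside out = trans (basis-on (fromℕℚ (coefficient (suc k′))) k) (cong fromℕℚ
    (binomials-vanish-outside p q l′ k′ (toℕ<n k) (⊎-map ℕ.s≤s⁻¹ ℕ.s≤s⁻¹ out)))
  number-of-terms : suc (p + suc l′) ∸ suc l′ ≡ suc p
  number-of-terms = trans (cong (_∸ l′) (+-suc p l′)) (ℕP.m+n∸n≡m (suc p) l′)
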